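{- Let $q$ be a prime power and $\nu\geq 1$ an integer. The symplectic inner product graph $Spi(2\nu,q)$ is connected if and only if $\nu\geq 2$. Moreover, if $Spi(2\nu,q)$ is connected, then its diameter is $4$.
   Context: $\mathbb{F}_q$ is the finite field with $q$ elements and $\mathbb{F}_q^{(2\nu)}$ is the space of row vectors of length $2\nu$ over $\mathbb{F}_q$. Let $K_{2\nu}=\begin{pmatrix}0 & I^{(\nu)}\\ -I^{(\nu)} & 0\end{pmatrix}$. A subspace $P$ of dimension $m$ is identified with any $m\times 2\nu$ matrix whose rows form a basis of $P$. The symplectic inner product graph $Spi(2\nu,q)$ has as vertex set all subspaces of $\mathbb{F}_q^{(2\nu)}$ other than $0$ and $\mathbb{F}_q^{(2\nu)}$, and vertices $A,B$ (not necessarily distinct) are adjacent iff $AK_{2\nu}{}^t B=0$, i.e. $\alpha K_{2\nu}{}^t\beta=0$ for all $\alpha\in A,\beta\in B$. A graph is connected if any two vertices are joined by a path; the distance between two vertices is the number of edges of a shortest path joining them, and the diameter is the greatest distance between two vertices. -}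

module Defs where

open import Level using (0ℓ)
open import Data.Nat using (ℕ; zero; suc; _≤_; _<_) renaming (_+_ to _+ℕ_; _^_ to _^ℕ_)
open import Data.Nat.Primality using (Prime)
open import Data.Fin using (Fin; _↑ˡ_; _↑ʳ_) renaming (zero to fzero; suc to fsuc)
open import Data.Product using (Σ; ∃; ∃-syntax; _×_; _,_)
open import Relation.Binary.PropositionalEquality using (_≡_; _≢_)
open import Relation.Nullary using (¬_)
open import Algebra.Structures using (IsCommutativeRing)
open import Function.Bundles using (_↔_)

IsPrimePower : ℕ → Set
IsPrimePower q = ∃[ p ] ∃[ k ] (Prime p × 1 ≤ k × q ≡ p ^ℕ k)

record FiniteField (q : ℕ) : Set₁ where
  infixl 6 _+_
  infixl 7 _*_
  field
    Carrier : Set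
    _+_ _*_ : Carrier → Carrier → Carrier
    -_      : Carrier → Carrier
    0# 1#   : Carrier
    isCommutativeRing : IsCommutativeRing _≡_ _+_ _*_ -_ 0# 1#
    0≢1     : 0# ≢ 1#
    inverse : ∀ x → x ≢ 0# → ∃[ y ] (x * y ≡ 1#)
    enum    : Carrier ↔ Fin q

module _ {q : ℕ} (F : FiniteField q) where
  open FiniteField F

  sumF : ∀ n → (Fin n → Carrier) → Carrier
  sumF zero    f = 0#
  sumF (suc n) f = f fzero + sumF n (λ i → f (fsuc i))

  Row : ℕ → Set
  Row n = Fin n → Carrier

  Mat : ℕ → ℕ → Set
  Mat m n = Fin m → Row n

  lincomb : ∀ {m n} → Row m → Mat m n → Row n
  lincomb {m} c M j = sumF m (λ i → c i * M i j)

  RowsIndependent : ∀ {m n} → Mat m n → Set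
  RowsIndependent {m} {n} M = ∀ (c : Row m) → (∀ j → lincomb c M j ≡ 0#) → ∀ i → c i ≡ 0#

  -- α K_{2ν} ᵗβ, where K_{2ν} = [[0, I],[-I, 0]] and indices of Fin (ν + ν)
  -- are split as (first block) i ↑ˡ ν and (second block) ν ↑ʳ i
  symp : ∀ ν → Row (ν +ℕ ν) → Row (ν +ℕ ν) → Carrier
  symp ν α β = sumF ν (λ i → α (i ↑ˡ ν) * β (ν ↑ʳ i) + - (α (ν ↑ʳ i) * β (i ↑ˡ ν)))

  record Subspace (ν : ℕ) : Set where
    constructor subspace
    field
      dim   : ℕ
      basis : Mat dim (ν +ℕ ν)
      indep : RowsIndependent basis

  open Subspace

  record Vertex (ν : ℕ) : Set where
    constructor vertex
    field
      sub      : Subspace ν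
      nonzero  : 1 ≤ dim sub
      proper   : dim sub < ν +ℕ ν

  open Vertex

  _∈span_ : ∀ {m n} → Row n → Mat m n → Set
  _∈span_ {m} α M = ∃[ c ] (∀ j → lincomb c M j ≡ α j)

  SameVertex : ∀ {ν} → Vertex ν → Vertex ν → Set
  SameVertex A B = (∀ i → basis (sub A) i ∈span basis (sub B))
                 × (∀ i → basis (sub B) i ∈span basis (sub A))

  Adj : ∀ {ν} → Vertex ν → Vertex ν → Set
  Adj {ν} A B = ∀ (α β : Row (ν +ℕ ν)) → α ∈span basis (sub A) → β ∈span basis (sub B)
                → symp ν α β ≡ 0#

  Walk : ∀ {ν} → ℕ → Vertex ν → Vertex ν → Set
  Walk zero    A B = SameVertex A B
  Walk (suc k) A B = ∃[ C ] (Adj A C × Walk k C B)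

  Connected : ℕ → Set
  Connected ν = ∀ (A B : Vertex ν) → ∃[ k ] Walk k A B

  DistLE : ∀ {ν} → Vertex ν → Vertex ν → ℕ → Set
  DistLE A B d = ∃[ k ] (k ≤ d × Walk k A B)

  HasDiameter : ℕ → ℕ → Set
  HasDiameter ν d = (∀ (A B : Vertex ν) → DistLE A B d)
                  × Σ (Vertex ν) (λ A → Σ (Vertex ν) (λ B → ∀ k → k < d → ¬ Walk k A B))

{-# OPTIONS --safe #-}

-- Write α ⊥ β for α K_{2ν} ᵗβ = 0. If A is a proper subspace with basis M, the
-- system (M K_{2ν}) ᵗu = 0 has fewer equations than unknowns, so some nonzero u is
-- orthogonal to A and A is adjacent to the line ⟨u⟩. For ν ≥ 2 two lines ⟨u⟩, ⟨v⟩
-- are both orthogonal to a third line ⟨w⟩, giving the walk A, ⟨u⟩, ⟨w⟩, ⟨v⟩, B.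
--
-- Let p* be the coordinate paired with p by K_{2ν} and H_p the hyperplane x_p = 0.
-- The vectors orthogonal to H_p are the multiples of e_{p*}, so every neighbour of
-- H_p lies in ⟨e_{p*}⟩ and every neighbour of H_{p*} in ⟨e_p⟩. Since e_p ∈ H_{p*}
-- is not orthogonal to e_{p*} ∈ H_p, the vertices H_p and H_{p*} are at distance at
-- least 4. For ν = 1 the neighbours of a line inside H_p = ⟨e_{p*}⟩ lie in H_p
-- again, so H_{p*} is unreachable.

module Submission where

open import Level using (0ℓ)
open import Data.Nat using (ℕ; zero; suc; _≤_; _<_; z≤n; s≤s) renaming (_+_ to _+ℕ_)
import Data.Nat.Properties as ℕ
open import Data.Fin using (Fin; _↑ˡ_; _↑ʳ_; splitAt; punchIn; punchOut)
  renaming (zero to fzero; suc to fsuc)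
import Data.Fin.Properties as Fin
open import Data.Product using (∃-syntax; _×_; _,_; proj₂)
open import Data.Sum using (_⊎_; inj₁; inj₂; [_,_]′)
open import Data.Empty using (⊥-elim)
open import Relation.Nullary using (¬_; yes; no)
open import Relation.Binary.Definitions using (DecidableEquality)
open import Relation.Binary.PropositionalEquality
  using (_≡_; _≢_; refl; sym; trans; cong; cong₂; subst; module ≡-Reasoning)
open import Algebra.Bundles using (CommutativeRing)
open import Algebra.Structures using (IsCommutativeRing)
open import Function.Base using (_∘_)
open import Function.Bundles using (_⇔_; mk⇔)
open import Function.Properties.Inverse using (↔⇒↣)
open import Defs

module _ {q : ℕ} (F : FiniteField q) where
  open FiniteField F
  open IsCommutativeRing isCommutativeRing
    using (+-comm; +-assoc; +-identityˡ; +-identityʳ; -‿inverseˡ; -‿inverseʳ;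
           *-comm; *-assoc; *-identityˡ; *-identityʳ; zeroˡ; zeroʳ; distribʳ)

  commutativeRing : CommutativeRing 0ℓ 0ℓ
  commutativeRing = record { isCommutativeRing = isCommutativeRing }

  open CommutativeRing commutativeRing using (ring; semiring; *-commutativeSemigroup)
  open import Algebra.Properties.Ring ring
    using (-‿distribˡ-*; -‿distribʳ-*; -0#≈0#; -‿involutive;
           +-inverseʳ-unique; ⁻¹-anti-homo‿-)
  open import Algebra.Properties.CommutativeSemigroup *-commutativeSemigroup
    using (x∙yz≈y∙xz)
  open import Algebra.Properties.Semiring.Sum semiring
    using (sum; sum-cong-≗; sum-replicate-zero; sum-remove; ∑-distrib-+; ∑-comm; *-distribˡ-sum)
  open ≡-Reasoning

  _≟_ : DecidableEquality Carrier
  _≟_ = Fin.inj⇒≟ (↔⇒↣ enum)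

  x≢0∧xy≡0⇒y≡0 : ∀ {x y} → x ≢ 0# → x * y ≡ 0# → y ≡ 0#
  x≢0∧xy≡0⇒y≡0 {x} {y} x≢0 xy≡0 with inverse x x≢0
  ... | x⁻¹ , xx⁻¹≡1 = begin
    y               ≡⟨ sym (*-identityʳ y) ⟩
    y * 1#          ≡⟨ cong (y *_) (sym xx⁻¹≡1) ⟩
    y * (x * x⁻¹)   ≡⟨ x∙yz≈y∙xz y x x⁻¹ ⟩
    x * (y * x⁻¹)   ≡⟨ sym (*-assoc x y x⁻¹) ⟩
    (x * y) * x⁻¹   ≡⟨ cong (_* x⁻¹) xy≡0 ⟩
    0# * x⁻¹        ≡⟨ zeroˡ x⁻¹ ⟩
    0#              ∎

  -x≡0⇒x≡0 : ∀ {x} → - x ≡ 0# → x ≡ 0#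
  -x≡0⇒x≡0 {x} -x≡0 = trans (sym (-‿involutive x)) (trans (cong -_ -x≡0) -0#≈0#)

  x≡0⇒-x≡0 : ∀ {x} → x ≡ 0# → - x ≡ 0#
  x≡0⇒-x≡0 refl = -0#≈0#

  x+y≡0∧x≡0⇒y≡0 : ∀ {x y} → x + y ≡ 0# → x ≡ 0# → y ≡ 0#
  x+y≡0∧x≡0⇒y≡0 {x} x+y≡0 x≡0 = trans (+-inverseʳ-unique x _ x+y≡0) (x≡0⇒-x≡0 x≡0)

  [xy-zw]+[wz-yx]≡0 : ∀ x y z w → (x * y + - (z * w)) + (w * z + - (y * x)) ≡ 0#
  [xy-zw]+[wz-yx]≡0 x y z w = begin
    d + (w * z + - (y * x))  ≡⟨ cong₂ (λ a b → d + (a + - b)) (*-comm w z) (*-comm y x) ⟩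
    d + (z * w + - (x * y))  ≡⟨ cong (d +_) (sym (⁻¹-anti-homo‿- (x * y) (z * w))) ⟩
    d + - d                  ≡⟨ -‿inverseʳ d ⟩
    0#                       ∎
    where d = x * y + - (z * w)

  sumF≡sum : ∀ n (f : Fin n → Carrier) → sumF F n f ≡ sum f
  sumF≡sum zero    f = refl
  sumF≡sum (suc n) f = cong (f fzero +_) (sumF≡sum n (f ∘ fsuc))

  sum-zero : ∀ {n} {f : Fin n → Carrier} → (∀ i → f i ≡ 0#) → sum f ≡ 0#
  sum-zero {n} f≡0 = trans (sum-cong-≗ f≡0) (sum-replicate-zero n)

  sum-supported : ∀ {n} (f : Fin n → Carrier) a → (∀ i → i ≢ a → f i ≡ 0#) → sum f ≡ f a
  sum-supported {suc n} f a f≡0 = begin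
    sum f                      ≡⟨ sum-remove f ⟩
    f a + sum (f ∘ punchIn a)  ≡⟨ cong (f a +_) (sum-zero (λ k → f≡0 _ (Fin.punchInᵢ≢i a k))) ⟩
    f a + 0#                   ≡⟨ +-identityʳ (f a) ⟩
    f a                        ∎

  sum-splitAt : ∀ m {n} (f : Fin (m +ℕ n) → Carrier) →
                sum f ≡ sum (f ∘ (_↑ˡ n)) + sum (f ∘ (m ↑ʳ_))
  sum-splitAt zero    f = sym (+-identityˡ _)
  sum-splitAt (suc m) f = trans (cong (f fzero +_) (sum-splitAt m (f ∘ fsuc))) (sym (+-assoc _ _ _))

  dot : ∀ {n} → Row F n → Row F n → Carrier
  dot x y = sum λ j → x j * y j

  unit : ∀ {n} → Fin n → Row F n
  unit a j with a Fin.≟ j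
  ... | yes _ = 1#
  ... | no  _ = 0#

  unit-diag : ∀ {n} (a : Fin n) → unit a a ≡ 1#
  unit-diag a with a Fin.≟ a
  ... | yes _   = refl
  ... | no  a≢a = ⊥-elim (a≢a refl)

  Nonzero : ∀ {n} → Row F n → Set
  Nonzero x = ¬ (∀ j → x j ≡ 0#)

  SupportedAt : ∀ {n} → Row F n → Fin n → Set
  SupportedAt x a = ∀ j → j ≢ a → x j ≡ 0#

  unit-supported : ∀ {n} (a : Fin n) → SupportedAt (unit a) a
  unit-supported a j j≢a with a Fin.≟ j
  ... | yes a≡j = ⊥-elim (j≢a (sym a≡j))
  ... | no  _   = refl

  unit-diag≢0 : ∀ {n} (a : Fin n) → unit a a ≢ 0#
  unit-diag≢0 a unit≡0 = 0≢1 (trans (sym unit≡0) (unit-diag a))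

  unit-nonzero : ∀ {n} (a : Fin n) → Nonzero (unit a)
  unit-nonzero a unit≡0 = unit-diag≢0 a (unit≡0 a)

  supported∧value≡0⇒zero : ∀ {n} {x : Row F n} {a} →
                           SupportedAt x a → x a ≡ 0# → ∀ j → x j ≡ 0#
  supported∧value≡0⇒zero {a = a} x∈⟨a⟩ xa≡0 j with j Fin.≟ a
  ... | yes refl = xa≡0
  ... | no  j≢a  = x∈⟨a⟩ j j≢a

  supported∧nonzero⇒value≢0 : ∀ {n} {x : Row F n} {a} → SupportedAt x a → Nonzero x → x a ≢ 0#
  supported∧nonzero⇒value≢0 x∈⟨a⟩ x≢0 = x≢0 ∘ supported∧value≡0⇒zero x∈⟨a⟩

  dot-supportedˡ : ∀ {n} {x : Row F n} {a} → SupportedAt x a → ∀ y → dot x y ≡ x a * y a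
  dot-supportedˡ {a = a} x∈⟨a⟩ y =
    sum-supported _ a λ j j≢a → trans (cong (_* y j) (x∈⟨a⟩ j j≢a)) (zeroˡ (y j))

  dot-unitʳ : ∀ {n} (x : Row F n) a → dot x (unit a) ≡ x a
  dot-unitʳ x a = begin
    dot x (unit a)  ≡⟨ sum-supported _ a (λ j j≢a → trans (cong (x j *_) (unit-supported a j j≢a))
                                                          (zeroʳ (x j))) ⟩
    x a * unit a a  ≡⟨ cong (x a *_) (unit-diag a) ⟩
    x a * 1#        ≡⟨ *-identityʳ (x a) ⟩
    x a             ∎

  dot-linearˡ : ∀ {n} a b (x y w : Row F n) →
                dot (λ k → a * x k + b * y k) w ≡ a * dot x w + b * dot y w
  dot-linearˡ a b x y w = begin
    sum (λ k → (a * x k + b * y k) * w k)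
      ≡⟨ sum-cong-≗ (λ k → trans (distribʳ (w k) _ _)
                                 (cong₂ _+_ (*-assoc a _ _) (*-assoc b _ _))) ⟩
    sum (λ k → a * (x k * w k) + b * (y k * w k))
      ≡⟨ ∑-distrib-+ (λ k → a * (x k * w k)) (λ k → b * (y k * w k)) ⟩
    sum (λ k → a * (x k * w k)) + sum (λ k → b * (y k * w k))
      ≡⟨ sym (cong₂ _+_ (*-distribˡ-sum a (λ k → x k * w k))
                        (*-distribˡ-sum b (λ k → y k * w k))) ⟩
    a * dot x w + b * dot y w ∎

  dot-scaleʳ : ∀ {n} a (x y : Row F n) → dot x (λ k → a * y k) ≡ a * dot x y
  dot-scaleʳ a x y =
    trans (sum-cong-≗ (λ k → x∙yz≈y∙xz (x k) a (y k))) (sym (*-distribˡ-sum a (λ k → x k * y k)))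

  dot-lincombʳ : ∀ {m n} (x : Row F n) (d : Row F m) (N : Mat F m n) →
                 dot x (lincomb F d N) ≡ sum (λ k → d k * dot x (N k))
  dot-lincombʳ {m} x d N = begin
    sum (λ j → x j * sumF F m (λ k → d k * N k j))
      ≡⟨ sum-cong-≗ (λ j → cong (x j *_) (sumF≡sum m _)) ⟩
    sum (λ j → x j * sum (λ k → d k * N k j))
      ≡⟨ sum-cong-≗ (λ j → *-distribˡ-sum (x j) (λ k → d k * N k j)) ⟩
    sum (λ j → sum (λ k → x j * (d k * N k j)))
      ≡⟨ ∑-comm (λ j k → x j * (d k * N k j)) ⟩
    sum (λ k → sum (λ j → x j * (d k * N k j)))
      ≡⟨ sum-cong-≗ (λ k → sum-cong-≗ (λ j → x∙yz≈y∙xz (x j) (d k) (N k j))) ⟩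
    sum (λ k → sum (λ j → d k * (x j * N k j)))
      ≡⟨ sum-cong-≗ (λ k → sym (*-distribˡ-sum (d k) (λ j → x j * N k j))) ⟩
    sum (λ k → d k * dot x (N k)) ∎

  row∈span : ∀ {m n} (M : Mat F m n) i → _∈span_ F (M i) M
  row∈span {m} M i = unit i , λ j → begin
    sumF F m (λ k → unit i k * M k j)  ≡⟨ sumF≡sum m _ ⟩
    sum (λ k → unit i k * M k j)       ≡⟨ sum-supported _ i (λ k k≢i →
                                            trans (cong (_* M k j) (unit-supported i k k≢i)) (zeroˡ _)) ⟩
    unit i i * M i j                   ≡⟨ cong (_* M i j) (unit-diag i) ⟩
    1# * M i j                         ≡⟨ *-identityˡ (M i j) ⟩
    M i j                              ∎

  lincomb-units : ∀ {m n} (σ : Fin m → Fin n) → (∀ i k → σ i ≡ σ k → i ≡ k) →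
                  ∀ (c : Row F m) i → lincomb F c (unit ∘ σ) (σ i) ≡ c i
  lincomb-units {m} σ σ-injective c i = begin
    sumF F m (λ k → c k * unit (σ k) (σ i))  ≡⟨ sumF≡sum m _ ⟩
    sum (λ k → c k * unit (σ k) (σ i))       ≡⟨ sum-supported _ i off-diagonal ⟩
    c i * unit (σ i) (σ i)                   ≡⟨ cong (c i *_) (unit-diag (σ i)) ⟩
    c i * 1#                                 ≡⟨ *-identityʳ (c i) ⟩
    c i                                      ∎
    where
    off-diagonal : ∀ k → k ≢ i → c k * unit (σ k) (σ i) ≡ 0#
    off-diagonal k k≢i =
      trans (cong (c k *_) (unit-supported (σ k) (σ i) (k≢i ∘ σ-injective k i ∘ sym))) (zeroʳ (c k))

  units-independent : ∀ {m n} (σ : Fin m → Fin n) → (∀ i k → σ i ≡ σ k → i ≡ k) →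
                      RowsIndependent F (unit ∘ σ)
  units-independent σ σ-injective c cσ≡0 i =
    trans (sym (lincomb-units σ σ-injective c i)) (cσ≡0 (σ i))

  ∈span-resp-≗ : ∀ {m n} {x y : Row F n} {M : Mat F m n} →
                 (∀ j → x j ≡ y j) → _∈span_ F x M → _∈span_ F y M
  ∈span-resp-≗ x≗y (c , cM≡x) = c , λ j → trans (cM≡x j) (x≗y j)

  ∈span-vanishes : ∀ {m n} {x : Row F n} {M : Mat F m n} j →
                   (∀ k → M k j ≡ 0#) → _∈span_ F x M → x j ≡ 0#
  ∈span-vanishes {m} {x = x} {M} j M≡0 (c , cM≡x) = begin
    x j                              ≡⟨ sym (cM≡x j) ⟩
    sumF F m (λ k → c k * M k j)     ≡⟨ sumF≡sum m _ ⟩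
    sum (λ k → c k * M k j)          ≡⟨ sum-zero (λ k → trans (cong (c k *_) (M≡0 k)) (zeroʳ _)) ⟩
    0#                               ∎

  dot-⊥-span : ∀ {m n} {x y : Row F n} {N : Mat F m n} →
               (∀ k → dot x (N k) ≡ 0#) → _∈span_ F y N → dot x y ≡ 0#
  dot-⊥-span {x = x} {y} {N} x⊥N (d , dN≡y) = begin
    dot x y                          ≡⟨ sum-cong-≗ (λ j → cong (x j *_) (sym (dN≡y j))) ⟩
    dot x (lincomb F d N)            ≡⟨ dot-lincombʳ x d N ⟩
    sum (λ k → d k * dot x (N k))    ≡⟨ sum-zero (λ k → trans (cong (d k *_) (x⊥N k)) (zeroʳ _)) ⟩
    0#                               ∎

  HasNontrivialSolution : ∀ {m n} → Mat F m n → Set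
  HasNontrivialSolution L = ∃[ u ] (Nonzero u × ∀ i → dot (L i) u ≡ 0#)

  eliminate : ∀ {m n} → Mat F (suc m) (suc n) → Fin (suc m) → Mat F m n
  eliminate L p i k = L p fzero * L r (fsuc k) + (- L r fzero) * L p (fsuc k)
    where r = punchIn p i

  -- Fraction-free elimination: the solution is rescaled by the pivot instead of dividing by it.
  eliminate-lift : ∀ {m n} (L : Mat F (suc m) (suc n)) p → L p fzero ≢ 0# →
                   HasNontrivialSolution (eliminate L p) → HasNontrivialSolution L
  eliminate-lift {n = n} L p a≢0 (w , w≢0 , L′w≡0) = u , u≢0 , Lu≡0
    where
    a = L p fzero
    D = dot (L p ∘ fsuc) w

    u : Row F (suc n)
    u fzero    = - D
    u (fsuc k) = a * w k

    u≢0 : Nonzero u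
    u≢0 u≡0 = w≢0 λ k → x≢0∧xy≡0⇒y≡0 a≢0 (u≡0 (fsuc k))

    dot-u : ∀ r → dot (L r) u ≡ L r fzero * - D + a * dot (L r ∘ fsuc) w
    dot-u r = cong (L r fzero * - D +_) (dot-scaleʳ a (L r ∘ fsuc) w)

    pivot-row : dot (L p) u ≡ 0#
    pivot-row = begin
      dot (L p) u       ≡⟨ dot-u p ⟩
      a * - D + a * D   ≡⟨ cong (_+ a * D) (sym (-‿distribʳ-* a D)) ⟩
      - (a * D) + a * D ≡⟨ -‿inverseˡ (a * D) ⟩
      0#                ∎

    other-row : ∀ i → dot (L (punchIn p i)) u ≡ 0#
    other-row i = begin
      dot (L r) u                    ≡⟨ dot-u r ⟩
      b * - D + a * E                ≡⟨ +-comm _ _ ⟩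
      a * E + b * - D                ≡⟨ cong (a * E +_) (trans (sym (-‿distribʳ-* b D))
                                                                 (-‿distribˡ-* b D)) ⟩
      a * E + - b * D                ≡⟨ sym (dot-linearˡ a (- b) (L r ∘ fsuc) (L p ∘ fsuc) w) ⟩
      dot (eliminate L p i) w        ≡⟨ L′w≡0 i ⟩
      0#                             ∎
      where
      r = punchIn p i
      b = L r fzero
      E = dot (L r ∘ fsuc) w

    Lu≡0 : ∀ r → dot (L r) u ≡ 0#
    Lu≡0 r with p Fin.≟ r
    ... | yes refl = pivot-row
    ... | no  p≢r  =
      subst (λ r → dot (L r) u ≡ 0#) (Fin.punchIn-punchOut p≢r) (other-row (punchOut p≢r))

  homogeneous-nontrivial : ∀ {m n} → m < n → (L : Mat F m n) → HasNontrivialSolution L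
  homogeneous-nontrivial {zero}  {suc n} _ L = unit fzero , unit-nonzero fzero , λ ()
  homogeneous-nontrivial {suc m} {suc n} (s≤s m<n) L with Fin.all? (λ i → L i fzero ≟ 0#)
  ... | yes column₀≡0 =
    unit fzero , unit-nonzero fzero , λ i → trans (dot-unitʳ (L i) fzero) (column₀≡0 i)
  ... | no  column₀≢0 with Fin.¬∀⟶∃¬ (suc m) _ (λ i → L i fzero ≟ 0#) column₀≢0
  ...   | p , Lp₀≢0 = eliminate-lift L p Lp₀≢0 (homogeneous-nontrivial m<n (eliminate L p))

  module Symplectic (ν : ℕ) where

    partner : Fin (ν +ℕ ν) → Fin (ν +ℕ ν)
    partner j = [ ν ↑ʳ_ , _↑ˡ ν ]′ (splitAt ν j)

    -- J α = α K_{2ν}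
    J : Row F (ν +ℕ ν) → Row F (ν +ℕ ν)
    J α j = [ (λ t → - α (ν ↑ʳ t)) , (λ t → α (t ↑ˡ ν)) ]′ (splitAt ν j)

    ↑ʳ≢↑ˡ : ∀ s t → ν ↑ʳ s ≢ t ↑ˡ ν
    ↑ʳ≢↑ˡ s t e
      with trans (sym (Fin.splitAt-↑ʳ ν ν s)) (trans (cong (splitAt ν) e) (Fin.splitAt-↑ˡ ν t ν))
    ... | ()

    partner-involutive : ∀ j → partner (partner j) ≡ j
    partner-involutive j with splitAt ν j in eq
    ... | inj₁ t = trans (cong [ ν ↑ʳ_ , _↑ˡ ν ]′ (Fin.splitAt-↑ʳ ν ν t))
                         (Fin.splitAt⁻¹-↑ˡ eq)
    ... | inj₂ t = trans (cong [ ν ↑ʳ_ , _↑ˡ ν ]′ (Fin.splitAt-↑ˡ ν t ν))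
                         (Fin.splitAt⁻¹-↑ʳ eq)

    partner-≢ : ∀ j → partner j ≢ j
    partner-≢ j with splitAt ν j in eq
    ... | inj₁ t = λ e → ↑ʳ≢↑ˡ t t (trans e (sym (Fin.splitAt⁻¹-↑ˡ eq)))
    ... | inj₂ t = λ e → ↑ʳ≢↑ˡ t t (trans (Fin.splitAt⁻¹-↑ʳ eq) (sym e))

    J-partner : ∀ α j → (J α j ≡ - α (partner j)) ⊎ (J α j ≡ α (partner j))
    J-partner α j with splitAt ν j
    ... | inj₁ t = inj₁ refl
    ... | inj₂ t = inj₂ refl

    J≡0⇒partner≡0 : ∀ α j → J α j ≡ 0# → α (partner j) ≡ 0#
    J≡0⇒partner≡0 α j with J-partner α j
    ... | inj₁ J≡-α = λ J≡0 → -x≡0⇒x≡0 (trans (sym J≡-α) J≡0)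
    ... | inj₂ J≡α  = trans (sym J≡α)

    partner≡0⇒J≡0 : ∀ α j → α (partner j) ≡ 0# → J α j ≡ 0#
    partner≡0⇒J≡0 α j with J-partner α j
    ... | inj₁ J≡-α = λ α≡0 → trans J≡-α (x≡0⇒-x≡0 α≡0)
    ... | inj₂ J≡α  = trans J≡α

    symp≡dot-J : ∀ α β → symp F ν α β ≡ dot (J α) β
    symp≡dot-J α β = begin
      symp F ν α β
        ≡⟨ sumF≡sum ν _ ⟩
      sum (λ t → α (t ↑ˡ ν) * β (ν ↑ʳ t) + - (α (ν ↑ʳ t) * β (t ↑ˡ ν)))
        ≡⟨ ∑-distrib-+ (λ t → α (t ↑ˡ ν) * β (ν ↑ʳ t))
                       (λ t → - (α (ν ↑ʳ t) * β (t ↑ˡ ν))) ⟩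
      sum (λ t → α (t ↑ˡ ν) * β (ν ↑ʳ t)) + sum (λ t → - (α (ν ↑ʳ t) * β (t ↑ˡ ν)))
        ≡⟨ +-comm _ _ ⟩
      sum (λ t → - (α (ν ↑ʳ t) * β (t ↑ˡ ν))) + sum (λ t → α (t ↑ˡ ν) * β (ν ↑ʳ t))
        ≡⟨ cong₂ _+_
             (sum-cong-≗ λ t → trans (-‿distribˡ-* _ _) (cong (_* β (t ↑ˡ ν)) (sym (J-↑ˡ t))))
             (sum-cong-≗ λ t → cong (_* β (ν ↑ʳ t)) (sym (J-↑ʳ t))) ⟩
      sum (λ t → J α (t ↑ˡ ν) * β (t ↑ˡ ν)) + sum (λ t → J α (ν ↑ʳ t) * β (ν ↑ʳ t))
        ≡⟨ sym (sum-splitAt ν _) ⟩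
      dot (J α) β ∎
      where
      J-↑ˡ : ∀ t → J α (t ↑ˡ ν) ≡ - α (ν ↑ʳ t)
      J-↑ˡ t = cong [ (λ s → - α (ν ↑ʳ s)) , (λ s → α (s ↑ˡ ν)) ]′
                    (Fin.splitAt-↑ˡ ν t ν)

      J-↑ʳ : ∀ t → J α (ν ↑ʳ t) ≡ α (t ↑ˡ ν)
      J-↑ʳ t = cong [ (λ s → - α (ν ↑ʳ s)) , (λ s → α (s ↑ˡ ν)) ]′
                    (Fin.splitAt-↑ʳ ν ν t)

    symp-antisym : ∀ α β → symp F ν α β ≡ 0# → symp F ν β α ≡ 0#
    symp-antisym α β = x+y≡0∧x≡0⇒y≡0 (begin
      symp F ν α β + symp F ν β α
        ≡⟨ cong₂ _+_ (sumF≡sum ν (term α β)) (sumF≡sum ν (term β α)) ⟩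
      sum (term α β) + sum (term β α)
        ≡⟨ sym (∑-distrib-+ (term α β) (term β α)) ⟩
      sum (λ t → term α β t + term β α t)
        ≡⟨ sum-zero (λ t → [xy-zw]+[wz-yx]≡0 (α (t ↑ˡ ν)) (β (ν ↑ʳ t))
                                             (α (ν ↑ʳ t)) (β (t ↑ˡ ν))) ⟩
      0# ∎)
      where
      term : Row F (ν +ℕ ν) → Row F (ν +ℕ ν) → Fin ν → Carrier
      term x y t = x (t ↑ˡ ν) * y (ν ↑ʳ t) + - (x (ν ↑ʳ t) * y (t ↑ˡ ν))

    symp-⊥-span : ∀ {m} {α β} {N : Mat F m (ν +ℕ ν)} → (∀ k → symp F ν α (N k) ≡ 0#) →
                  _∈span_ F β N → symp F ν α β ≡ 0#
    symp-⊥-span {α = α} {β} {N} α⊥N β∈N =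
      trans (symp≡dot-J α β) (dot-⊥-span (λ k → trans (sym (symp≡dot-J α (N k))) (α⊥N k)) β∈N)

    symp-⊥-exists : ∀ {m} → m < ν +ℕ ν → (M : Mat F m (ν +ℕ ν)) →
                    ∃[ u ] (Nonzero u × ∀ i → symp F ν (M i) u ≡ 0#)
    symp-⊥-exists m<2ν M with homogeneous-nontrivial m<2ν (J ∘ M)
    ... | u , u≢0 , JMu≡0 = u , u≢0 , λ i → trans (symp≡dot-J (M i) u) (JMu≡0 i)

    symp-supported : ∀ {c a} → SupportedAt c a → c a ≢ 0# →
                     ∀ d → symp F ν c d ≡ 0# → d (partner a) ≡ 0#
    symp-supported {c} {a} c∈⟨a⟩ ca≢0 d c⊥d = x≢0∧xy≡0⇒y≡0 Jc≢0 (begin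
      J c (partner a) * d (partner a) ≡⟨ sym (dot-supportedˡ Jc∈⟨a*⟩ d) ⟩
      dot (J c) d                     ≡⟨ sym (symp≡dot-J c d) ⟩
      symp F ν c d                    ≡⟨ c⊥d ⟩
      0#                              ∎)
      where
      Jc∈⟨a*⟩ : SupportedAt (J c) (partner a)
      Jc∈⟨a*⟩ j j≢a* = partner≡0⇒J≡0 c j (c∈⟨a⟩ (partner j)
        λ j*≡a → j≢a* (trans (sym (partner-involutive j)) (cong partner j*≡a)))
      Jc≢0 : J c (partner a) ≢ 0#
      Jc≢0 J≡0 =
        ca≢0 (subst (λ k → c k ≡ 0#) (partner-involutive a) (J≡0⇒partner≡0 c (partner a) J≡0))

    rows : (A : Vertex F ν) → Mat F (Subspace.dim (Vertex.sub A)) (ν +ℕ ν)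
    rows A = Subspace.basis (Vertex.sub A)

    _∈ᵥ_ : Row F (ν +ℕ ν) → Vertex F ν → Set
    x ∈ᵥ A = _∈span_ F x (rows A)

    rows-⊥⇒Adj : ∀ A B → (∀ i k → symp F ν (rows A i) (rows B k) ≡ 0#) → Adj F A B
    rows-⊥⇒Adj A B A⊥B α β α∈A β∈B = symp-⊥-span {α = α} {N = rows B} α⊥B β∈B
      where
      α⊥B : ∀ k → symp F ν α (rows B k) ≡ 0#
      α⊥B k = symp-antisym (rows B k) α
        (symp-⊥-span {α = rows B k} {N = rows A}
                     (λ i → symp-antisym (rows A i) (rows B k) (A⊥B i k)) α∈A)

    SameVertex-refl : ∀ A → SameVertex F A A
    SameVertex-refl A = row∈span (rows A) , row∈span (rows A)

    vertex-nonzero : ∀ A → ∃[ c ] (Nonzero c × c ∈ᵥ A)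
    vertex-nonzero (vertex (subspace zero    M _)     () _)
    vertex-nonzero (vertex (subspace (suc d) M indep) _  _) = M fzero , M₀≢0 , row∈span M fzero
      where
      M₀≢0 : Nonzero (M fzero)
      M₀≢0 M₀≡0 =
        unit-nonzero fzero (indep (unit fzero) λ j → trans (proj₂ (row∈span M fzero) j) (M₀≡0 j))

    line : (u : Row F (ν +ℕ ν)) → Nonzero u → 1 < ν +ℕ ν → Vertex F ν
    line u u≢0 1<2ν = vertex (subspace 1 (λ _ → u) independent) (s≤s z≤n) 1<2ν
      where
      independent : RowsIndependent F (λ (_ : Fin 1) → u)
      independent c cu≡0 fzero with c fzero ≟ 0#
      ... | yes c≡0 = c≡0
      ... | no  c≢0 =
        ⊥-elim (u≢0 λ j → x≢0∧xy≡0⇒y≡0 c≢0 (trans (sym (+-identityʳ _)) (cu≡0 j)))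

    walk-of-length-4 : 2 < ν +ℕ ν → ∀ A B → Walk F 4 A B
    walk-of-length-4 2<2ν A B
      with symp-⊥-exists (Vertex.proper A) (rows A) | symp-⊥-exists (Vertex.proper B) (rows B)
    ... | u , u≢0 , A⊥u | v , v≢0 , B⊥v with symp-⊥-exists 2<2ν (λ { fzero → u ; (fsuc _) → v })
    ... | w , w≢0 , uv⊥w =
        ⟨u⟩ , rows-⊥⇒Adj A ⟨u⟩ (λ i _ → A⊥u i)
      , ⟨w⟩ , rows-⊥⇒Adj ⟨u⟩ ⟨w⟩ (λ _ _ → uv⊥w fzero)
      , ⟨v⟩ , rows-⊥⇒Adj ⟨w⟩ ⟨v⟩ (λ _ _ → symp-antisym v w (uv⊥w (fsuc fzero)))
      , B   , rows-⊥⇒Adj ⟨v⟩ B (λ _ k → symp-antisym (rows B k) v (B⊥v k))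
      , SameVertex-refl B
      where
      1<2ν = ℕ.<-trans (s≤s (s≤s z≤n)) 2<2ν
      ⟨u⟩ = line u u≢0 1<2ν
      ⟨v⟩ = line v v≢0 1<2ν
      ⟨w⟩ = line w w≢0 1<2ν

    VanishesAt : Vertex F ν → Fin (ν +ℕ ν) → Set
    VanishesAt A p = ∀ i → rows A i p ≡ 0#

  module Hyperplanes (ν′ : ℕ) where
    open Symplectic (suc ν′)

    hyperplane : Fin (suc ν′ +ℕ suc ν′) → Vertex F (suc ν′)
    hyperplane p = vertex (subspace _ (unit ∘ punchIn p) independent)
                          (ℕ.≤-trans (s≤s z≤n) (ℕ.m≤n+m (suc ν′) ν′)) (ℕ.n<1+n _)
      where independent = units-independent (punchIn p) (Fin.punchIn-injective p)

    hyperplane-vanishes : ∀ p → VanishesAt (hyperplane p) p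
    hyperplane-vanishes p i = unit-supported (punchIn p i) p (λ e → Fin.punchInᵢ≢i p i (sym e))

    hyperplane⊆⇒unit∈ : ∀ p {a m} {M : Mat F m (suc ν′ +ℕ suc ν′)} →
                        (∀ i → _∈span_ F (rows (hyperplane p) i) M) → p ≢ a → _∈span_ F (unit a) M
    hyperplane⊆⇒unit∈ p H⊆M p≢a =
      ∈span-resp-≗ (λ j → cong (λ b → unit b j) (Fin.punchIn-punchOut p≢a)) (H⊆M (punchOut p≢a))

    vanishes⇒¬≈hyperplane : ∀ p C → VanishesAt C p → ¬ SameVertex F C (hyperplane (partner p))
    vanishes⇒¬≈hyperplane p C C|p (_ , H*⊆C) =
      unit-diag≢0 p (∈span-vanishes p C|p (hyperplane⊆⇒unit∈ (partner p) H*⊆C (partner-≢ p)))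

    ⊥units⇒supported : ∀ p {c} → (∀ a → p ≢ a → symp F (suc ν′) (unit a) c ≡ 0#) →
                       SupportedAt c (partner p)
    ⊥units⇒supported p {c} c⊥units j j≢p* = subst (λ k → c k ≡ 0#) (partner-involutive j)
      (symp-supported (unit-supported a) (unit-diag≢0 a) c (c⊥units a p≢a))
      where
      a = partner j
      p≢a : p ≢ a
      p≢a p≡a = j≢p* (trans (sym (partner-involutive j)) (cong partner (sym p≡a)))

    Adj-from-hyperplane : ∀ p C {c} → Adj F (hyperplane p) C → c ∈ᵥ C → SupportedAt c (partner p)
    Adj-from-hyperplane p C H∼C c∈C = ⊥units⇒supported p λ a p≢a →
      H∼C (unit a) _ (hyperplane⊆⇒unit∈ p (row∈span (rows (hyperplane p))) p≢a) c∈C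

    Adj-to-hyperplane : ∀ p C D {c} → Adj F C D → SameVertex F D (hyperplane (partner p)) →
                        c ∈ᵥ C → SupportedAt c p
    Adj-to-hyperplane p C D {c} C∼D (_ , H*⊆D) c∈C =
      subst (SupportedAt c) (partner-involutive p) (⊥units⇒supported (partner p) λ a p*≢a →
        symp-antisym c (unit a) (C∼D c (unit a) c∈C (hyperplane⊆⇒unit∈ (partner p) H*⊆D p*≢a)))

    no-short-walk : ∀ p k → k < 4 → ¬ Walk F k (hyperplane p) (hyperplane (partner p))
    no-short-walk p 0 _ H≈H* = vanishes⇒¬≈hyperplane p (hyperplane p) (hyperplane-vanishes p) H≈H*
    no-short-walk p 1 _ (C , H∼C , _ , H*⊆C) = unit-diag≢0 p (e_p∈⟨e_p*⟩ p (partner-≢ p ∘ sym))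
      where
      e_p∈⟨e_p*⟩ : SupportedAt (unit p) (partner p)
      e_p∈⟨e_p*⟩ =
        Adj-from-hyperplane p C H∼C (hyperplane⊆⇒unit∈ (partner p) H*⊆C (partner-≢ p))
    no-short-walk p 2 _ (C , H∼C , D , C∼D , D≈H*) with vertex-nonzero C
    ... | c , c≢0 , c∈C =
      c≢0 (supported∧value≡0⇒zero c∈⟨p*⟩ (c∈⟨p⟩ (partner p) (partner-≢ p)))
      where
      c∈⟨p*⟩ = Adj-from-hyperplane p C H∼C c∈C
      c∈⟨p⟩  = Adj-to-hyperplane p C D C∼D D≈H* c∈C
    no-short-walk p 3 _ (C , H∼C , D , C∼D , E , D∼E , E≈H*) with vertex-nonzero C | vertex-nonzero D
    ... | c , c≢0 , c∈C | d , d≢0 , d∈D =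
      supported∧nonzero⇒value≢0 d∈⟨p⟩ d≢0
        (subst (λ k → d k ≡ 0#) (partner-involutive p) d[p**]≡0)
      where
      c∈⟨p*⟩ = Adj-from-hyperplane p C H∼C c∈C
      d∈⟨p⟩  = Adj-to-hyperplane p D E D∼E E≈H* d∈D
      d[p**]≡0 : d (partner (partner p)) ≡ 0#
      d[p**]≡0 =
        symp-supported c∈⟨p*⟩ (supported∧nonzero⇒value≢0 c∈⟨p*⟩ c≢0) d (C∼D c d c∈C d∈D)
    no-short-walk p (suc (suc (suc (suc _)))) (s≤s (s≤s (s≤s (s≤s ()))))

  module Plane where
    open Symplectic 1
    open Hyperplanes 0

    partner-only : ∀ p j → j ≢ partner p → j ≡ p
    partner-only fzero        fzero        _    = refl
    partner-only fzero        (fsuc fzero) j≢p* = ⊥-elim (j≢p* refl)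
    partner-only (fsuc fzero) fzero        j≢p* = ⊥-elim (j≢p* refl)
    partner-only (fsuc fzero) (fsuc fzero) _    = refl

    vanishing-step : ∀ p C D → VanishesAt C p → Adj F C D → VanishesAt D p
    vanishing-step p C D C|p C∼D i with vertex-nonzero C
    ... | c , c≢0 , c∈C = subst (λ k → rows D i k ≡ 0#) (partner-involutive p)
      (symp-supported c∈⟨p*⟩ (supported∧nonzero⇒value≢0 c∈⟨p*⟩ c≢0) (rows D i)
        (C∼D c (rows D i) c∈C (row∈span (rows D) i)))
      where
      c∈⟨p*⟩ : SupportedAt c (partner p)
      c∈⟨p*⟩ j j≢p* =
        subst (λ k → c k ≡ 0#) (sym (partner-only p j j≢p*)) (∈span-vanishes p C|p c∈C)

    vanishes⇒¬Walk : ∀ p k C → VanishesAt C p → ¬ Walk F k C (hyperplane (partner p))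
    vanishes⇒¬Walk p zero    C C|p = vanishes⇒¬≈hyperplane p C C|p
    vanishes⇒¬Walk p (suc k) C C|p (D , C∼D , walk) =
      vanishes⇒¬Walk p k D (vanishing-step p C D C|p C∼D) walk

    ¬connected : ¬ Connected F 1
    ¬connected conn with conn (hyperplane fzero) (hyperplane (partner fzero))
    ... | k , walk = vanishes⇒¬Walk fzero k (hyperplane fzero) (hyperplane-vanishes fzero) walk

connected⇒2≤ν : ∀ {q} (F : FiniteField q) ν → 1 ≤ ν → Connected F ν → 2 ≤ ν
connected⇒2≤ν F 1             _ conn = ⊥-elim (Plane.¬connected F conn)
connected⇒2≤ν F (suc (suc ν)) _ _    = s≤s (s≤s z≤n)

2≤ν⇒2<ν+ν : ∀ {ν} → 2 ≤ ν → 2 < ν +ℕ ν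
2≤ν⇒2<ν+ν {ν} 2≤ν =
  ℕ.≤-trans (s≤s 2≤ν) (ℕ.+-monoˡ-≤ ν (ℕ.≤-trans (s≤s z≤n) 2≤ν))

diameter-4 : ∀ {q} (F : FiniteField q) ν → 2 ≤ ν → HasDiameter F ν 4
diameter-4 F (suc ν′) 2≤ν =
    (λ A B → 4 , ℕ.≤-refl , walk-of-length-4 (2≤ν⇒2<ν+ν 2≤ν) A B)
  , hyperplane fzero , hyperplane (partner fzero) , no-short-walk fzero
  where
  open Symplectic F (suc ν′)
  open Hyperplanes F ν′

theorem2p1 : (q : ℕ) → IsPrimePower q → (F : FiniteField q) → (ν : ℕ) → 1 ≤ ν →
    (Connected F ν ⇔ 2 ≤ ν) × (Connected F ν → HasDiameter F ν 4)
theorem2p1 q _ F ν 1≤ν =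
    mk⇔ (connected⇒2≤ν F ν 1≤ν)
        (λ 2≤ν A B → 4 , Symplectic.walk-of-length-4 F ν (2≤ν⇒2<ν+ν 2≤ν) A B)
  , λ conn → diameter-4 F ν (connected⇒2≤ν F ν 1≤ν conn)
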